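{- There is an absolute constant $C$ such that every acyclic ordered path system with at most $n$ nodes and at most $p$ paths that is half-$4$-bridge-free has size at most $C\left(n+n^{2/3}p^{2/3}+p\right)$. Equivalently, $H(n,p,4)\le O(n+n^{2/3}p^{2/3}+p)$.
   Context: A path system is a pair $(V,\Pi)$ with $\Pi$ a collection of nonempty vertex sequences (paths); the size is $\sum_{\pi\in\Pi}|\pi|$ where $|\pi|$ is the number of vertices of $\pi$. It is ordered if $\Pi$ carries a total order, and acyclic if some total order on $V$ agrees with the vertex order within every path. A subsystem is obtained by deleting paths, deleting nodes, or deleting single occurrences of nodes from paths. A $k$-bridge is a system with nodes $x_1,\dots,x_k$ and $k$ two-node paths: the river $(x_1,x_k)$ and the arcs $(x_i,x_{i+1})$, $1\le i<k$ (the last arc is $(x_{k-1},x_k)$); degenerate occurrences count. An ordered path system is half-$k$-bridge-free if it contains no subsystem that is a $j$-bridge with $2\le j\le k$ in which the last arc comes before the river in the order of $\Pi$ (orders inherited). $H(n,p,k)$ denotes the maximum size of a half-$k$-bridge-free (acyclic) ordered path system with $n$ nodes and $p$ paths. -}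

module Defs where

open import Data.Nat using (ℕ; zero; suc; _+_; _*_; _∸_; _^_; _≤_; _<_)
open import Data.Fin as Fin using (Fin; inject₁; fromℕ)
open import Data.List using (List; []; _∷_; length; lookup; map)
open import Data.Nat.ListAction using (sum)
open import Data.List.Relation.Unary.All using (All)
open import Data.Product using (Σ; _×_; ∃)
open import Relation.Binary.PropositionalEquality using (_≡_; _≢_)
open import Relation.Nullary using (¬_)
open import Function.Definitions using (Injective)

Path : ℕ → Set
Path m = List (Fin m)

NonEmpty : {A : Set} → List A → Set
NonEmpty [] = Data.Empty.⊥ where import Data.Empty
NonEmpty (_ ∷ _) = Data.Unit.⊤ where import Data.Unit

-- An ordered path system on node set Fin m: the list order is the total order on Π.
record OPS (m : ℕ) : Set where
  field
    paths    : List (Path m)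
    nonempty : All NonEmpty paths
open OPS public

numPaths : ∀ {m} → OPS m → ℕ
numPaths S = length (paths S)

size : ∀ {m} → OPS m → ℕ
size S = sum (map length (paths S))

PathIx : ∀ {m} → OPS m → Set
PathIx S = Fin (numPaths S)

path : ∀ {m} (S : OPS m) → PathIx S → Path m
path S i = lookup (paths S) i

Precedes : ∀ {m} → Path m → Fin m → Fin m → Set
Precedes π x y =
  Σ (Fin (length π)) λ i → Σ (Fin (length π)) λ j →
    (i Fin.< j) × (lookup π i ≡ x) × (lookup π j ≡ y)

-- Acyclic: some (strict) total order on V, given as an injective ranking
-- V → ℕ, agrees with the vertex order within every path.
Acyclic : ∀ {m} → OPS m → Set
Acyclic {m} S =
  Σ (Fin m → ℕ) λ rank → Injective _≡_ _≡_ rank ×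
    All (λ π → ∀ (i j : Fin (length π)) → i Fin.< j →
                 rank (lookup π i) < rank (lookup π j)) (paths S)

-- A subsystem of S that is a (t+2)-bridge with nodes x_0 … x_{t+1}:
-- river = path r containing (x_0 , x_{t+1}) in this order,
-- arc i = path (arc i) containing (x_i , x_{i+1}) in this order,
-- all t+2 paths distinct.  "Half": the last arc precedes the river in Π.
record HalfBridge {m} (S : OPS m) (t : ℕ) : Set where
  field
    node      : Fin (suc (suc t)) → Fin m
    river     : PathIx S
    arc       : Fin (suc t) → PathIx S
    arc-inj   : Injective _≡_ _≡_ arc
    river≢arc : ∀ i → arc i ≢ river
    river-ok  : Precedes (path S river) (node Fin.zero) (node (fromℕ (suc t)))
    arc-ok    : ∀ i → Precedes (path S (arc i)) (node (inject₁ i)) (node (Fin.suc i))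
    half      : arc (fromℕ t) Fin.< river

HalfBridgeFree : ∀ {m} → ℕ → OPS m → Set
HalfBridgeFree k S = ∀ t → t + 2 ≤ k → ¬ HalfBridge S t

{-# OPTIONS --safe #-}
-- Rank the vertices so that every path increases.  For an occurrence of a vertex x on a path
-- π let a be the number of earlier paths through x and b the number of vertices before x on π.
-- Two distinct paths share at most one vertex (no half 2-bridge), and no half 3-bridge exists,
-- so a pair (π′, u) with π′ an earlier path through x and u before x on π determines the
-- occurrence: hence Σ a·b ≤ np.  Occurrences are also determined by (x, a) and by (π, b), so at
-- most nA of them have a < A and at most pB have b < B; every other occurrence has a·b ≥ AB.
-- Thus AB·size ≤ np + AB(nA + pB), and A = ⌊size/4n⌋, B = ⌊size/4p⌋ give size³ ≤ 128 (np)²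
-- once size > 8(n + p).
module Submission where

open import Defs
open import Data.Nat using (ℕ; _+_; _*_; _∸_; _^_; _≤_)
open import Data.Product using (Σ)

open import Data.Nat using (suc; _<_; _<?_; z≤n; s≤s; z<s; s<s; NonZero; >-nonZero)
open import Data.Nat.Properties
open import Data.Nat.DivMod using (_/_; _%_; m≡m%n+[m/n]*n; m%n<n; m/n*n≤m; m≥n⇒m/n>0)
open import Data.Nat.Tactic.RingSolver using (solve-∀)
open import Data.Nat.ListAction using (sum)
open import Data.Fin as F using (Fin)
import Data.Fin.Properties as FP
open import Data.List
  using (List; []; _∷_; length; lookup; map; filter; concatMap; cartesianProduct; _++_; allFin; tabulate; upTo)
open import Data.List.Properties
  using (length-++; length-map; length-tabulate; length-upTo; map-cong; map-tabulate; tabulate-lookup)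
open import Data.List.Relation.Unary.All as All using (All; []; _∷_)
import Data.List.Relation.Unary.All.Properties as All
open import Data.List.Relation.Unary.AllPairs as AllPairs using (AllPairs; []; _∷_)
open import Data.List.Relation.Unary.Any using (here; there; index)
open import Data.List.Relation.Unary.Any.Properties using (lookup-index)
open import Data.List.Relation.Unary.Unique.Propositional using (Unique)
import Data.List.Relation.Unary.Unique.Propositional.Properties as Unique
open import Data.List.Relation.Binary.Subset.Propositional using (_⊆_)
open import Data.List.Relation.Binary.Disjoint.Propositional using (Disjoint)
open import Data.List.Membership.Propositional using (_∈_; find)
open import Data.List.Membership.Propositional.Properties
  using ( ∈-∃++; ∈-++⁻; ∈-++⁺ˡ; ∈-++⁺ʳ; ∈-map⁻; ∈-concatMap⁻; ∈-filter⁻; ∈-lookup; ∈-allFin; ∈-upTo⁺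
        ; ∈-cartesianProduct⁺; ∈-cartesianProduct⁻)
open import Data.Product using (_×_; _,_; proj₁; proj₂)
open import Data.Product.Properties using (,-injective)
open import Data.Sum using (_⊎_; inj₁; inj₂)
open import Data.Empty using (⊥; ⊥-elim)
open import Function using (_∘_; id)
open import Function.Definitions using (Injective)
open import Relation.Binary.PropositionalEquality
  using (_≡_; _≢_; refl; sym; trans; cong; cong₂; subst; subst₂; ≢-sym; module ≡-Reasoning)
open import Relation.Binary.Definitions using (tri<; tri≈; tri>)
open import Relation.Nullary using (¬_; yes; no; contradiction; _×-dec_)
open import Relation.Unary using (Decidable)
open import Relation.Unary.Properties using (_∪?_)
open import Algebra.Properties.CommutativeSemigroup +-commutativeSemigroup using (x∙yz≈y∙xz)

private variable
  A B : Set
  xs ys : List A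

length-allFin : ∀ n → length (allFin n) ≡ n
length-allFin n = length-tabulate (id {A = Fin n})

length-concatMap : (f : A → List B) (xs : List A) →
                   length (concatMap f xs) ≡ sum (map (length ∘ f) xs)
length-concatMap f []       = refl
length-concatMap f (x ∷ xs) =
  trans (length-++ (f x)) (cong (length (f x) +_) (length-concatMap f xs))

length-cartesianProduct : (xs : List A) (ys : List B) →
                          length (cartesianProduct xs ys) ≡ length xs * length ys
length-cartesianProduct []       ys = refl
length-cartesianProduct (x ∷ xs) ys =
  trans (length-++ (map (x ,_) ys))
        (cong₂ _+_ (length-map (x ,_) ys) (length-cartesianProduct xs ys))

lookup⇒AllPairs : {R : A → A → Set} →
                  (∀ {q r} → q F.< r → R (lookup xs q) (lookup xs r)) → AllPairs R xs
lookup⇒AllPairs {xs = []}     _              = []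
lookup⇒AllPairs {xs = x ∷ xs} {R} R-lookup =
  All.tabulate (λ y∈xs → subst (R x) (sym (lookup-index y∈xs))
                               (R-lookup {F.zero} {F.suc (index y∈xs)} z<s))
  ∷ lookup⇒AllPairs (λ q<r → R-lookup (s<s q<r))

Unique∧⊆⇒length≤ : Unique xs → xs ⊆ ys → length xs ≤ length ys
Unique∧⊆⇒length≤ {xs = []}     _                  _     = z≤n
Unique∧⊆⇒length≤ {xs = x ∷ xs} (x∉xs ∷ xs-unique) xs⊆ys with ∈-∃++ (xs⊆ys (here refl))
... | ys₁ , ys₂ , refl = begin
  suc (length xs)               ≤⟨ s≤s (Unique∧⊆⇒length≤ xs-unique xs⊆ys₁ys₂) ⟩
  suc (length (ys₁ ++ ys₂))     ≡⟨ cong suc (length-++ ys₁) ⟩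
  suc (length ys₁ + length ys₂) ≡⟨ +-suc (length ys₁) (length ys₂) ⟨
  length ys₁ + suc (length ys₂) ≡⟨ length-++ ys₁ ⟨
  length (ys₁ ++ x ∷ ys₂)       ∎
  where
  open ≤-Reasoning
  xs⊆ys₁ys₂ : xs ⊆ ys₁ ++ ys₂
  xs⊆ys₁ys₂ y∈xs with ∈-++⁻ ys₁ (xs⊆ys (there y∈xs))
  ... | inj₁ y∈ys₁         = ∈-++⁺ˡ y∈ys₁
  ... | inj₂ (here refl)   = contradiction refl (All.lookup x∉xs y∈xs)
  ... | inj₂ (there y∈ys₂) = ∈-++⁺ʳ ys₁ y∈ys₂

InjectiveOn : List A → (A → B) → Set
InjectiveOn xs f = ∀ {x y} → x ∈ xs → y ∈ xs → f x ≡ f y → x ≡ y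

map⁺-injectiveOn : {f : A → B} → Unique xs → InjectiveOn xs f → Unique (map f xs)
map⁺-injectiveOn {xs = []}     []                 _   = []
map⁺-injectiveOn {xs = x ∷ xs} (x∉xs ∷ xs-unique) inj =
  All.map⁺ (All.tabulate λ y∈xs → All.lookup x∉xs y∈xs ∘ inj (here refl) (there y∈xs))
  ∷ map⁺-injectiveOn xs-unique (λ x∈xs y∈xs → inj (there x∈xs) (there y∈xs))

injectiveOn⇒length≤ : {f : A → B} → Unique xs → InjectiveOn xs f →
                      (∀ {x} → x ∈ xs → f x ∈ ys) → length xs ≤ length ys
injectiveOn⇒length≤ {xs = xs} {f = f} xs-unique inj into =
  subst (_≤ _) (length-map f xs) (Unique∧⊆⇒length≤ (map⁺-injectiveOn xs-unique inj) image⊆)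
  where
  image⊆ : map f xs ⊆ _
  image⊆ fx∈ with ∈-map⁻ f fx∈
  ... | x , x∈xs , refl = into x∈xs

filter-injectiveOn⇒length≤ : {P : A → Set} (P? : Decidable P) {f : A → B} →
                             Unique xs → InjectiveOn xs f → (∀ {x} → x ∈ xs → P x → f x ∈ ys) →
                             length (filter P? xs) ≤ length ys
filter-injectiveOn⇒length≤ P? xs-unique inj into =
  injectiveOn⇒length≤ (Unique.filter⁺ P? xs-unique)
    (λ x∈ y∈ → inj (proj₁ (∈-filter⁻ P? x∈)) (proj₁ (∈-filter⁻ P? y∈)))
    (λ x∈ → let x∈xs , px = ∈-filter⁻ P? x∈ in into x∈xs px)

concatMap⁺ : {f : A → List B} → Unique xs → (∀ {x} → x ∈ xs → Unique (f x)) →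
             (∀ {x y v} → x ∈ xs → y ∈ xs → v ∈ f x → v ∈ f y → x ≡ y) →
             Unique (concatMap f xs)
concatMap⁺ {xs = []}         _                  _        _   = []
concatMap⁺ {xs = x ∷ xs} {f} (x∉xs ∷ xs-unique) f-unique sep =
  Unique.++⁺ (f-unique (here refl))
    (concatMap⁺ xs-unique (f-unique ∘ there) (λ x∈xs y∈xs → sep (there x∈xs) (there y∈xs)))
    disjoint
  where
  disjoint : Disjoint (f x) (concatMap f xs)
  disjoint (v∈fx , v∈rest) with find (∈-concatMap⁻ f v∈rest)
  ... | y , y∈xs , v∈fy = All.lookup x∉xs y∈xs (sep (here refl) (there y∈xs) v∈fx v∈fy)

module _ {P Q : A → Set} (P? : Decidable P) (Q? : Decidable Q) where

  length-filter-mono : (∀ {z} → P z → Q z) → ∀ xs →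
                       length (filter P? xs) ≤ length (filter Q? xs)
  length-filter-mono P⇒Q []       = z≤n
  length-filter-mono P⇒Q (x ∷ xs) with ih ← length-filter-mono P⇒Q xs | P? x | Q? x
  ... | yes _  | yes _  = s≤s ih
  ... | yes px | no ¬qx = contradiction (P⇒Q px) ¬qx
  ... | no _   | yes _  = m≤n⇒m≤1+n ih
  ... | no _   | no _   = ih

  length-filter-strictMono : (∀ {z} → P z → Q z) → ∀ {z xs} → z ∈ xs → ¬ P z → Q z →
                             length (filter P? xs) < length (filter Q? xs)
  length-filter-strictMono P⇒Q {xs = x ∷ xs} (here refl) ¬pz qz with P? x | Q? x
  ... | yes pz | _      = contradiction pz ¬pz
  ... | no _   | yes _  = s≤s (length-filter-mono P⇒Q xs)
  ... | no _   | no ¬qz = contradiction qz ¬qz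
  length-filter-strictMono P⇒Q {xs = x ∷ xs} (there z∈xs) ¬pz qz
    with ih ← length-filter-strictMono P⇒Q z∈xs ¬pz qz | P? x | Q? x
  ... | yes _  | yes _  = s≤s ih
  ... | yes px | no ¬qx = contradiction (P⇒Q px) ¬qx
  ... | no _   | yes _  = m<n⇒m<1+n ih
  ... | no _   | no _   = ih

  length-filter-∪ : ∀ xs →
                    length (filter (P? ∪? Q?) xs) ≤ length (filter P? xs) + length (filter Q? xs)
  length-filter-∪ []       = z≤n
  length-filter-∪ (x ∷ xs) with ih ← length-filter-∪ xs | P? x | Q? x
  ... | yes _ | yes _ = s≤s (≤-trans ih (+-monoʳ-≤ _ (n≤1+n _)))
  ... | yes _ | no _  = s≤s ih
  ... | no _  | yes _ = ≤-trans (s≤s ih) (≤-reflexive (sym (+-suc _ _)))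
  ... | no _  | no _  = ih

markov-filter : {P : A → Set} (P? : Decidable P) (c : ℕ) (f : A → ℕ) →
                (∀ {x} → ¬ P x → c ≤ f x) → ∀ xs →
                c * length xs ≤ sum (map f xs) + c * length (filter P? xs)
markov-filter P? c f c≤f []       = ≤-refl
markov-filter P? c f c≤f (x ∷ xs) with ih ← markov-filter P? c f c≤f xs | P? x
... | yes _ = begin
  c * suc (length xs)    ≡⟨ *-suc c _ ⟩
  c + c * length xs      ≤⟨ +-monoʳ-≤ c ih ⟩
  c + (Σf + c * k)       ≡⟨ x∙yz≈y∙xz c Σf (c * k) ⟩
  Σf + (c + c * k)       ≡⟨ cong (Σf +_) (*-suc c k) ⟨
  Σf + c * suc k         ≤⟨ m≤n+m _ (f x) ⟩
  f x + (Σf + c * suc k) ≡⟨ +-assoc (f x) Σf _ ⟨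
  f x + Σf + c * suc k   ∎
  where
  open ≤-Reasoning
  Σf k : ℕ
  Σf = sum (map f xs)
  k  = length (filter P? xs)
... | no ¬px = begin
  c * suc (length xs) ≡⟨ *-suc c _ ⟩
  c + c * length xs   ≤⟨ +-mono-≤ (c≤f ¬px) ih ⟩
  f x + (Σf + c * k)  ≡⟨ +-assoc (f x) Σf _ ⟨
  f x + Σf + c * k    ∎
  where
  open ≤-Reasoning
  Σf k : ℕ
  Σf = sum (map f xs)
  k  = length (filter P? xs)

module _ {m} {S : OPS m} where

  half-2-bridge : ∀ {arc river x y} → arc F.< river →
                  Precedes (path S arc) x y → Precedes (path S river) x y → HalfBridge S 0
  half-2-bridge {arc} {river} {x} {y} arc<river arc-ok river-ok = record
    { node      = λ { F.zero → x ; (F.suc F.zero) → y }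
    ; river     = river
    ; arc       = λ _ → arc
    ; arc-inj   = λ { {F.zero} {F.zero} _ → refl }
    ; river≢arc = λ { F.zero → FP.<⇒≢ arc<river }
    ; river-ok  = river-ok
    ; arc-ok    = λ { F.zero → arc-ok }
    ; half      = arc<river
    }

  half-3-bridge : ∀ {arc₁ arc₂ river x₀ x₁ x₂} → arc₁ ≢ arc₂ → arc₁ ≢ river → arc₂ F.< river →
                  Precedes (path S arc₁) x₀ x₁ → Precedes (path S arc₂) x₁ x₂ →
                  Precedes (path S river) x₀ x₂ → HalfBridge S 1
  half-3-bridge {arc₁} {arc₂} {river} {x₀} {x₁} {x₂}
                arc₁≢arc₂ arc₁≢river arc₂<river arc₁-ok arc₂-ok river-ok = record
    { node      = λ { F.zero → x₀ ; (F.suc F.zero) → x₁ ; (F.suc (F.suc F.zero)) → x₂ }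
    ; river     = river
    ; arc       = arc
    ; arc-inj   = λ { {F.zero}       {F.zero}       _ → refl
                    ; {F.zero}       {F.suc F.zero} e → contradiction e arc₁≢arc₂
                    ; {F.suc F.zero} {F.zero}       e → contradiction (sym e) arc₁≢arc₂
                    ; {F.suc F.zero} {F.suc F.zero} _ → refl }
    ; river≢arc = λ { F.zero → arc₁≢river ; (F.suc F.zero) → FP.<⇒≢ arc₂<river }
    ; river-ok  = river-ok
    ; arc-ok    = λ { F.zero → arc₁-ok ; (F.suc F.zero) → arc₂-ok }
    ; half      = arc₂<river
    }
    where
    arc : Fin 2 → PathIx S
    arc F.zero    = arc₁
    arc (F.suc _) = arc₂

  pair-in-one-path : ¬ HalfBridge S 0 → ∀ {i j x y} → i ≢ j →
                     Precedes (path S i) x y → ¬ Precedes (path S j) x y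
  pair-in-one-path no-bridge {i} {j} i≢j x≺ᵢy x≺ⱼy with FP.<-cmp i j
  ... | tri< i<j _ _ = no-bridge (half-2-bridge i<j x≺ᵢy x≺ⱼy)
  ... | tri≈ _ i≡j _ = i≢j i≡j
  ... | tri> _ _ j<i = no-bridge (half-2-bridge j<i x≺ⱼy x≺ᵢy)

HalfBridgeFree-mono : ∀ {m k k'} {S : OPS m} → k ≤ k' → HalfBridgeFree k' S → HalfBridgeFree k S
HalfBridgeFree-mono k≤k' free t t+2≤k = free t (≤-trans t+2≤k k≤k')

module Ranked {m} (S : OPS m) (rank : Fin m → ℕ) (rank-injective : Injective _≡_ _≡_ rank)
  (increasing : All (λ π → ∀ q r → q F.< r → rank (lookup π q) < rank (lookup π r)) (paths S))
  where

  open import Data.List.Membership.DecPropositional (FP._≟_ {m}) using (_∈?_)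

  increasing-on : ∀ i {q r} → q F.< r → rank (lookup (path S i) q) < rank (lookup (path S i) r)
  increasing-on i q<r = All.lookup increasing (∈-lookup {xs = paths S} i) _ _ q<r

  path-unique : ∀ i → Unique (path S i)
  path-unique i =
    AllPairs.map (λ rx<ry → <⇒≢ rx<ry ∘ cong rank) (lookup⇒AllPairs (increasing-on i))

  precedes : ∀ {i x y} → x ∈ path S i → y ∈ path S i → rank x < rank y → Precedes (path S i) x y
  precedes {i} x∈π y∈π rx<ry with FP.<-cmp (index x∈π) (index y∈π)
  ... | tri< q<r _ _ =
    index x∈π , index y∈π , q<r , sym (lookup-index x∈π) , sym (lookup-index y∈π)
  ... | tri≈ _ q≡r _ = contradiction
    (trans (lookup-index x∈π) (trans (cong (lookup (path S i)) q≡r) (sym (lookup-index y∈π))))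
    (<⇒≢ rx<ry ∘ cong rank)
  ... | tri> _ _ r<q = contradiction
    (subst₂ (λ v u → rank v < rank u) (sym (lookup-index y∈π)) (sym (lookup-index x∈π))
            (increasing-on i r<q))
    (<-asym rx<ry)

  -- Paths repeat no vertex, so an occurrence of a vertex on a path is a (path, vertex) pair.
  Occurrence : Set
  Occurrence = PathIx S × Fin m

  occurrences-on : PathIx S → List Occurrence
  occurrences-on i = map (i ,_) (path S i)

  occurrences : List Occurrence
  occurrences = concatMap occurrences-on (allFin (numPaths S))

  ∈-occurrences⁻ : ∀ {i x} → (i , x) ∈ occurrences → x ∈ path S i
  ∈-occurrences⁻ o∈ with find (∈-concatMap⁻ occurrences-on {xs = allFin _} o∈)
  ... | i , _ , o∈πᵢ with ∈-map⁻ (i ,_) o∈πᵢ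
  ...   | _ , x∈πᵢ , refl = x∈πᵢ

  occurrences-unique : Unique occurrences
  occurrences-unique =
    concatMap⁺ (Unique.allFin⁺ _) (λ {i} _ → Unique.map⁺ (cong proj₂) (path-unique i)) same-path
    where
    same-path : ∀ {i j o} → i ∈ allFin _ → j ∈ allFin _ →
                o ∈ occurrences-on i → o ∈ occurrences-on j → i ≡ j
    same-path _ _ o∈ᵢ o∈ⱼ with ∈-map⁻ _ o∈ᵢ | ∈-map⁻ _ o∈ⱼ
    ... | _ , _ , refl | _ , _ , refl = refl

  length-occurrences : length occurrences ≡ size S
  length-occurrences = begin
    length occurrences                               ≡⟨ length-concatMap occurrences-on (allFin _) ⟩
    sum (map (length ∘ occurrences-on) (allFin _))
      ≡⟨ cong sum (map-cong (λ i → length-map (i ,_) (path S i)) (allFin _)) ⟩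
    sum (map (length ∘ lookup (paths S)) (allFin _))
      ≡⟨ cong sum (map-tabulate id (length ∘ lookup (paths S))) ⟩
    sum (tabulate (length ∘ lookup (paths S)))       ≡⟨ cong sum (map-tabulate (lookup (paths S)) length) ⟨
    sum (map length (tabulate (lookup (paths S))))   ≡⟨ cong (sum ∘ map length) (tabulate-lookup (paths S)) ⟩
    size S                                           ∎
    where open ≡-Reasoning

  all-pairs : List (PathIx S × Fin m)
  all-pairs = cartesianProduct (allFin (numPaths S)) (allFin m)

  ∈-all-pairs : ∀ c → c ∈ all-pairs
  ∈-all-pairs (j , u) = ∈-cartesianProduct⁺ (∈-allFin j) (∈-allFin u)

  length-all-pairs : length all-pairs ≡ m * numPaths S
  length-all-pairs = begin
    length all-pairs
      ≡⟨ length-cartesianProduct (allFin (numPaths S)) (allFin m) ⟩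
    length (allFin (numPaths S)) * length (allFin m)
      ≡⟨ cong₂ _*_ (length-allFin (numPaths S)) (length-allFin m) ⟩
    numPaths S * m
      ≡⟨ *-comm (numPaths S) m ⟩
    m * numPaths S ∎
    where open ≡-Reasoning

  size≤ : size S ≤ m * numPaths S
  size≤ = subst₂ _≤_ length-occurrences length-all-pairs
                 (Unique∧⊆⇒length≤ occurrences-unique (λ {o} _ → ∈-all-pairs o))

  earlier? : (o : Occurrence) → Decidable (λ j → j F.< proj₁ o × proj₂ o ∈ path S j)
  earlier? (i , x) j = j F.<? i ×-dec x ∈? path S j

  earlier : Occurrence → List (PathIx S)
  earlier o = filter (earlier? o) (allFin (numPaths S))

  before? : (o : Occurrence) → Decidable (λ u → rank u < rank (proj₂ o))
  before? (_ , x) u = rank u <? rank x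

  before : Occurrence → List (Fin m)
  before o = filter (before? o) (path S (proj₁ o))

  #earlier #before weight : Occurrence → ℕ
  #earlier = length ∘ earlier
  #before  = length ∘ before
  weight o = #earlier o * #before o

  #earlier-< : ∀ {i i' x} → i F.< i' → x ∈ path S i → #earlier (i , x) < #earlier (i' , x)
  #earlier-< {i} {i'} {x} i<i' x∈πᵢ =
    length-filter-strictMono (earlier? (i , x)) (earlier? (i' , x))
      (λ (j<i , x∈πⱼ) → FP.<-trans j<i i<i' , x∈πⱼ)
      (∈-allFin i) (FP.<-irrefl refl ∘ proj₁) (i<i' , x∈πᵢ)

  #before-< : ∀ {i x x'} → x ∈ path S i → rank x < rank x' → #before (i , x) < #before (i , x')
  #before-< {i} {x} {x'} x∈πᵢ rx<rx' =
    length-filter-strictMono (before? (i , x)) (before? (i , x'))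
      (λ ru<rx → <-trans ru<rx rx<rx')
      x∈πᵢ (n≮n _) rx<rx'

  vertex,#earlier-injective : InjectiveOn occurrences (λ o → proj₂ o , #earlier o)
  vertex,#earlier-injective {i , x} {i' , _} o∈ o'∈ e with ,-injective e
  ... | refl , same-count with FP.<-cmp i i'
  ...   | tri< i<i' _ _ =
    contradiction same-count (<⇒≢ (#earlier-< i<i' (∈-occurrences⁻ o∈)))
  ...   | tri≈ _ refl _ = refl
  ...   | tri> _ _ i'<i =
    contradiction (sym same-count) (<⇒≢ (#earlier-< i'<i (∈-occurrences⁻ o'∈)))

  path,#before-injective : InjectiveOn occurrences (λ o → proj₁ o , #before o)
  path,#before-injective {i , x} {_ , x'} o∈ o'∈ e with ,-injective e
  ... | refl , same-count with <-cmp (rank x) (rank x')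
  ...   | tri< rx<rx' _ _ =
    contradiction same-count (<⇒≢ (#before-< (∈-occurrences⁻ o∈) rx<rx'))
  ...   | tri≈ _ rx≡rx' _ = cong (i ,_) (rank-injective rx≡rx')
  ...   | tri> _ _ rx'<rx =
    contradiction (sym same-count) (<⇒≢ (#before-< (∈-occurrences⁻ o'∈) rx'<rx))

  few-light-earlier : ∀ A → length (filter (λ o → #earlier o <? A) occurrences) ≤ m * A
  few-light-earlier A = begin
    length (filter (λ o → #earlier o <? A) occurrences)
      ≤⟨ filter-injectiveOn⇒length≤ _ occurrences-unique vertex,#earlier-injective
           (λ _ a<A → ∈-cartesianProduct⁺ (∈-allFin _) (∈-upTo⁺ a<A)) ⟩
    length (cartesianProduct (allFin m) (upTo A))
      ≡⟨ length-cartesianProduct (allFin m) (upTo A) ⟩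
    length (allFin m) * length (upTo A)
      ≡⟨ cong₂ _*_ (length-allFin m) (length-upTo A) ⟩
    m * A ∎
    where open ≤-Reasoning

  few-light-before : ∀ B → length (filter (λ o → #before o <? B) occurrences) ≤ numPaths S * B
  few-light-before B = begin
    length (filter (λ o → #before o <? B) occurrences)
      ≤⟨ filter-injectiveOn⇒length≤ _ occurrences-unique path,#before-injective
           (λ _ b<B → ∈-cartesianProduct⁺ (∈-allFin _) (∈-upTo⁺ b<B)) ⟩
    length (cartesianProduct (allFin (numPaths S)) (upTo B))
      ≡⟨ length-cartesianProduct (allFin (numPaths S)) (upTo B) ⟩
    length (allFin (numPaths S)) * length (upTo B)
      ≡⟨ cong₂ _*_ (length-allFin (numPaths S)) (length-upTo B) ⟩
    numPaths S * B ∎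
    where open ≤-Reasoning

  crossings : Occurrence → List (PathIx S × Fin m)
  crossings o = cartesianProduct (earlier o) (before o)

  ∈-crossings⁻ : ∀ {i x j u} → (j , u) ∈ crossings (i , x) →
                 j F.< i × x ∈ path S j × u ∈ path S i × rank u < rank x
  ∈-crossings⁻ {i} {x} c∈ with ∈-cartesianProduct⁻ (earlier (i , x)) (before (i , x)) c∈
  ... | j∈ , u∈ =
    let j<i , x∈πⱼ = proj₂ (∈-filter⁻ (earlier? (i , x)) {xs = allFin (numPaths S)} j∈)
    in  j<i , x∈πⱼ , ∈-filter⁻ (before? (i , x)) u∈

  module HalfBridgeFree3 (half-3-bridge-free : HalfBridgeFree 3 S) where

    no-half-2-bridge : ¬ HalfBridge S 0
    no-half-2-bridge = half-3-bridge-free 0 (s≤s (s≤s z≤n))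

    no-half-3-bridge : ¬ HalfBridge S 1
    no-half-3-bridge = half-3-bridge-free 1 ≤-refl

    common-vertex-unique : ∀ {i j x y} → i ≢ j →
                           x ∈ path S i → x ∈ path S j → y ∈ path S i → y ∈ path S j → x ≡ y
    common-vertex-unique {x = x} {y} i≢j x∈πᵢ x∈πⱼ y∈πᵢ y∈πⱼ with <-cmp (rank x) (rank y)
    ... | tri< rx<ry _ _ = contradiction (precedes x∈πⱼ y∈πⱼ rx<ry)
      (pair-in-one-path no-half-2-bridge i≢j (precedes x∈πᵢ y∈πᵢ rx<ry))
    ... | tri≈ _ rx≡ry _ = rank-injective rx≡ry
    ... | tri> _ _ ry<rx = contradiction (precedes y∈πⱼ x∈πⱼ ry<rx)
      (pair-in-one-path no-half-2-bridge i≢j (precedes y∈πᵢ x∈πᵢ ry<rx))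

    no-crossing : ∀ {i i' j u x x'} → i ≢ i' → j F.< i → j F.< i' →
                  u ∈ path S i → x ∈ path S i → u ∈ path S i' → x' ∈ path S i' →
                  x ∈ path S j → x' ∈ path S j → rank u < rank x → rank x < rank x' → ⊥
    no-crossing i≢i' j<i j<i' u∈πᵢ x∈πᵢ u∈πᵢ' x'∈πᵢ' x∈πⱼ x'∈πⱼ ru<rx rx<rx' =
      no-half-3-bridge (half-3-bridge (≢-sym (FP.<⇒≢ j<i)) i≢i' j<i'
        (precedes u∈πᵢ x∈πᵢ ru<rx) (precedes x∈πⱼ x'∈πⱼ rx<rx')
        (precedes u∈πᵢ' x'∈πᵢ' (<-trans ru<rx rx<rx')))

    crossing-determines-occurrence : ∀ {o o' c} → o ∈ occurrences → o' ∈ occurrences →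
                                     c ∈ crossings o → c ∈ crossings o' → o ≡ o'
    crossing-determines-occurrence {i , x} {i' , x'} {j , u} o∈ o'∈ c∈ c∈'
      with ∈-occurrences⁻ o∈ | ∈-occurrences⁻ o'∈ | ∈-crossings⁻ c∈ | ∈-crossings⁻ c∈'
    ... | x∈πᵢ | x'∈πᵢ' | j<i , x∈πⱼ , u∈πᵢ , ru<rx | j<i' , x'∈πⱼ , u∈πᵢ' , ru<rx'
      with i FP.≟ i'
    ... | yes refl =
      cong (i ,_) (common-vertex-unique (≢-sym (FP.<⇒≢ j<i)) x∈πᵢ x∈πⱼ x'∈πᵢ' x'∈πⱼ)
    ... | no i≢i' with <-cmp (rank x) (rank x')
    ...   | tri< rx<rx' _ _ =
      ⊥-elim (no-crossing i≢i' j<i j<i' u∈πᵢ x∈πᵢ u∈πᵢ' x'∈πᵢ' x∈πⱼ x'∈πⱼ ru<rx rx<rx')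
    ...   | tri> _ _ rx'<rx =
      ⊥-elim (no-crossing (≢-sym i≢i') j<i' j<i u∈πᵢ' x'∈πᵢ' u∈πᵢ x∈πᵢ x'∈πⱼ x∈πⱼ ru<rx' rx'<rx)
    ...   | tri≈ _ rx≡rx' _ with rank-injective rx≡rx'
    ...     | refl = contradiction (common-vertex-unique i≢i' u∈πᵢ u∈πᵢ' x∈πᵢ x'∈πᵢ')
                                   (<⇒≢ ru<rx ∘ cong rank)

    crossings-unique : Unique (concatMap crossings occurrences)
    crossings-unique = concatMap⁺ occurrences-unique
      (λ {o} _ → Unique.cartesianProduct⁺ (Unique.filter⁺ (earlier? o) (Unique.allFin⁺ _))
                                          (Unique.filter⁺ (before? o) (path-unique (proj₁ o))))
      crossing-determines-occurrence

    sum-weight≤ : sum (map weight occurrences) ≤ m * numPaths S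
    sum-weight≤ = begin
      sum (map weight occurrences)
        ≡⟨ cong sum (map-cong (λ o → length-cartesianProduct (earlier o) (before o)) occurrences) ⟨
      sum (map (length ∘ crossings) occurrences)
        ≡⟨ length-concatMap crossings occurrences ⟨
      length (concatMap crossings occurrences)
        ≤⟨ Unique∧⊆⇒length≤ crossings-unique (λ {c} _ → ∈-all-pairs c) ⟩
      length all-pairs
        ≡⟨ length-all-pairs ⟩
      m * numPaths S ∎
      where open ≤-Reasoning

    incidence-bound : ∀ A B →
                      A * B * size S ≤ m * numPaths S + A * B * (m * A + numPaths S * B)
    incidence-bound A B = begin
      A * B * size S
        ≡⟨ cong (A * B *_) length-occurrences ⟨
      A * B * length occurrences
        ≤⟨ markov-filter light? (A * B) weight heavy occurrences ⟩
      sum (map weight occurrences) + A * B * length (filter light? occurrences)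
        ≤⟨ +-mono-≤ sum-weight≤ (*-monoʳ-≤ (A * B) (≤-trans (length-filter-∪ _ _ occurrences)
                                   (+-mono-≤ (few-light-earlier A) (few-light-before B)))) ⟩
      m * numPaths S + A * B * (m * A + numPaths S * B) ∎
      where
      open ≤-Reasoning
      light? : Decidable (λ o → #earlier o < A ⊎ #before o < B)
      light? = (λ o → #earlier o <? A) ∪? (λ o → #before o <? B)
      heavy : ∀ {o} → ¬ (#earlier o < A ⊎ #before o < B) → A * B ≤ weight o
      heavy ¬light = *-mono-≤ (≮⇒≥ (¬light ∘ inj₁)) (≮⇒≥ (¬light ∘ inj₂))

floor-doubling : ∀ E d .{{_ : NonZero d}} → d ≤ E → E ≤ 2 * (E / d * d)
floor-doubling E d d≤E = <⇒≤ (begin-strict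
  E                     ≡⟨ m≡m%n+[m/n]*n E d ⟩
  E % d + E / d * d     <⟨ +-monoˡ-< _ (m%n<n E d) ⟩
  d + E / d * d         ≤⟨ +-monoˡ-≤ _ (m≤n*m d (E / d) {{>-nonZero (m≥n⇒m/n>0 d≤E)}}) ⟩
  E / d * d + E / d * d ≡⟨ cong (E / d * d +_) (+-identityʳ _) ⟨
  2 * (E / d * d)       ∎)
  where open ≤-Reasoning

balanced-incidence : ∀ {n p A B E} → A * B * E ≤ n * p + A * B * (n * A + p * B) →
                     A * (4 * n) ≤ E → B * (4 * p) ≤ E → A * B * E ≤ 2 * (n * p)
balanced-incidence {n} {p} {A} {B} {E} incidence A4n≤E B4p≤E =
  *-cancelˡ-≤ 2 (+-cancelʳ-≤ (2 * X) (2 * X) (2 * (2 * (n * p))) (begin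
    2 * X + 2 * X
      ≡⟨ double-double X ⟩
    4 * X
      ≤⟨ *-monoʳ-≤ 4 incidence ⟩
    4 * (n * p + A * B * (n * A + p * B))
      ≡⟨ spread n p A B ⟩
    2 * (2 * (n * p)) + A * B * (A * (4 * n) + B * (4 * p))
      ≤⟨ +-monoʳ-≤ _ (*-monoʳ-≤ (A * B) (+-mono-≤ A4n≤E B4p≤E)) ⟩
    2 * (2 * (n * p)) + A * B * (E + E)
      ≡⟨ cong (2 * (2 * (n * p)) +_) (twice A B E) ⟩
    2 * (2 * (n * p)) + 2 * X ∎))
  where
  open ≤-Reasoning
  X : ℕ
  X = A * B * E
  double-double : ∀ x → 2 * x + 2 * x ≡ 4 * x
  double-double = solve-∀
  spread : ∀ n p A B → 4 * (n * p + A * B * (n * A + p * B)) ≡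
                       2 * (2 * (n * p)) + A * B * (A * (4 * n) + B * (4 * p))
  spread = solve-∀
  twice : ∀ A B E → A * B * (E + E) ≡ 2 * (A * B * E)
  twice = solve-∀

cube-bound : ∀ n p E .{{_ : NonZero n}} .{{_ : NonZero p}} → 4 * n ≤ E → 4 * p ≤ E →
             (∀ A B → A * B * E ≤ n * p + A * B * (n * A + p * B)) → E ^ 3 ≤ 128 * (n * p) ^ 2
cube-bound n p E 4n≤E 4p≤E incidence = begin
  E ^ 3
    ≤⟨ *-monoʳ-≤ E (*-mono-≤ (floor-doubling E (4 * n) 4n≤E)
                             (*-monoˡ-≤ 1 (floor-doubling E (4 * p) 4p≤E))) ⟩
  E * (2 * (a * (4 * n)) * (2 * (b * (4 * p)) * 1))
    ≡⟨ regroup E a b n p ⟩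
  64 * (n * p) * (a * b * E)
    ≤⟨ *-monoʳ-≤ (64 * (n * p)) (balanced-incidence {n} {p} {a} {b} (incidence a b)
                                   (m/n*n≤m E (4 * n)) (m/n*n≤m E (4 * p))) ⟩
  64 * (n * p) * (2 * (n * p))
    ≡⟨ collect (n * p) ⟩
  128 * (n * p) ^ 2 ∎
  where
  open ≤-Reasoning
  instance
    4n≢0 : NonZero (4 * n)
    4n≢0 = m*n≢0 4 n
    4p≢0 : NonZero (4 * p)
    4p≢0 = m*n≢0 4 p
  a b : ℕ
  a = E / (4 * n)
  b = E / (4 * p)
  regroup : ∀ E a b n p →
            E * (2 * (a * (4 * n)) * (2 * (b * (4 * p)) * 1)) ≡ 64 * (n * p) * (a * b * E)
  regroup = solve-∀
  collect : ∀ x → 64 * x * (2 * x) ≡ 128 * (x * (x * 1))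
  collect = solve-∀

cube-root-bound : ∀ n p E → E ≤ n * p → (∀ A B → A * B * E ≤ n * p + A * B * (n * A + p * B)) →
                  (E ∸ 8 * (n + p)) ^ 3 ≤ 8 ^ 3 * (n * p) ^ 2
cube-root-bound n p E E≤np incidence with E ≤? 8 * (n + p)
... | yes E≤8[n+p] rewrite m≤n⇒m∸n≡0 E≤8[n+p] = z≤n
... | no E≰8[n+p] = begin
  (E ∸ 8 * (n + p)) ^ 3 ≤⟨ ^-monoˡ-≤ 3 (m∸n≤m E (8 * (n + p))) ⟩
  E ^ 3                 ≤⟨ cube-bound n p E 4n≤E 4p≤E incidence ⟩
  128 * (n * p) ^ 2     ≤⟨ *-monoˡ-≤ ((n * p) ^ 2) (m≤m+n 128 384) ⟩
  8 ^ 3 * (n * p) ^ 2   ∎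
  where
  open ≤-Reasoning
  8[n+p]≤E : 8 * (n + p) ≤ E
  8[n+p]≤E = <⇒≤ (≰⇒> E≰8[n+p])
  4n≤E : 4 * n ≤ E
  4n≤E = ≤-trans (*-mono-≤ (m≤m+n 4 4) (m≤m+n n p)) 8[n+p]≤E
  4p≤E : 4 * p ≤ E
  4p≤E = ≤-trans (*-mono-≤ (m≤m+n 4 4) (m≤n+m p n)) 8[n+p]≤E
  instance
    np≢0 : NonZero (n * p)
    np≢0 = >-nonZero (<-≤-trans (≤-<-trans z≤n (≰⇒> E≰8[n+p])) E≤np)
    n≢0 : NonZero n
    n≢0 = m*n≢0⇒m≢0 n
    p≢0 : NonZero p
    p≢0 = m*n≢0⇒n≢0 n

incidence-mono : ∀ {m q n p} A B → m ≤ n → q ≤ p →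
                 m * q + A * B * (m * A + q * B) ≤ n * p + A * B * (n * A + p * B)
incidence-mono A B m≤n q≤p =
  +-mono-≤ (*-mono-≤ m≤n q≤p)
           (*-monoʳ-≤ (A * B) (+-mono-≤ (*-monoˡ-≤ A m≤n) (*-monoˡ-≤ B q≤p)))

lemma30 : Σ ℕ λ C → ∀ (n p m : ℕ) (S : OPS m) → m ≤ n → numPaths S ≤ p →
    Acyclic S → HalfBridgeFree 4 S →
    (size S ∸ C * (n + p)) ^ 3 ≤ C ^ 3 * ((n * p) ^ 2)
lemma30 = 8 , bound
  where
  bound : ∀ (n p m : ℕ) (S : OPS m) → m ≤ n → numPaths S ≤ p → Acyclic S → HalfBridgeFree 4 S →
          (size S ∸ 8 * (n + p)) ^ 3 ≤ 8 ^ 3 * ((n * p) ^ 2)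
  bound n p m S m≤n #paths≤p (rank , rank-injective , increasing) half-4-bridge-free =
    cube-root-bound n p (size S)
      (≤-trans size≤ (*-mono-≤ m≤n #paths≤p))
      (λ A B → ≤-trans (incidence-bound A B) (incidence-mono A B m≤n #paths≤p))
    where
    open Ranked S rank rank-injective increasing
    open HalfBridgeFree3 (HalfBridgeFree-mono (n≤1+n 3) half-4-bridge-free)
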